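{- Let $k\in\mathbb{N}$. Every bridgeless minor-obstruction of $\mathcal{V}_k$ is a minor-obstruction of $\mathcal{F}^{(k)}$.
   Context: $\mathcal{V}_k$ is the class of graphs with a vertex cover of size at most $k$. For $X\subseteq V(G)$, $G/\!\!/X$ is obtained from $G$ by deleting $X$ and adding a new vertex adjacent to every vertex of $N_G(X)=\bigcup_{v\in X}N_G(v)\setminus X$. For a partition $\mathcal{X}=\{X_1,\dots,X_p\}$ of some subset of $V(G)$ into non-empty parts, $G/\!\!/\mathcal{X}:=G/\!\!/X_1\cdots/\!\!/X_p$, with order $|X_1\cup\dots\cup X_p|$. $\mathsf{idf}(G)$ is the minimum order of such $\mathcal{X}$ with $G/\!\!/\mathcal{X}$ acyclic, and $\mathcal{F}^{(k)}=\{G\mid\mathsf{idf}(G)\le k\}$. A minor-obstruction of a class $\mathcal{C}$ is a graph not in $\mathcal{C}$ all of whose proper minors are in $\mathcal{C}$. Bridgeless: no edge whose removal increases the number of connected components. -}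

module Defs where

open import Data.Nat using (ℕ; suc; _≤_; _<_)
open import Data.Fin using (Fin)
open import Data.Fin.Subset using (Subset; ∣_∣; _∈_)
open import Data.Bool using (Bool; true; false)
open import Data.Maybe using (Maybe; just; nothing; is-just)
open import Data.Sum using (_⊎_; inj₁; inj₂)
open import Data.Product using (Σ; ∃; ∃-syntax; _×_; _,_)
open import Data.List using (List; []; _∷_; _++_; [_]; length)
open import Data.List.Relation.Unary.Linked using (Linked)
open import Data.List.Relation.Unary.Unique.Propositional using (Unique)
open import Data.Vec using (tabulate)
open import Data.Empty using (⊥)
open import Relation.Nullary using (¬_)
open import Relation.Binary.PropositionalEquality using (_≡_; _≢_)
open import Function.Bundles using (_↔_; Inverse)

record Graph (n : ℕ) : Set where
  field
    adj    : Fin n → Fin n → Bool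
    sym    : ∀ u v → adj u v ≡ adj v u
    irrefl : ∀ v → adj v v ≡ false
open Graph public

Edge : ∀ {n} → Graph n → Fin n → Fin n → Set
Edge G u v = adj G u v ≡ true

data Walk {A : Set} (R : A → A → Set) : A → A → Set where
  here : ∀ {u} → Walk R u u
  step : ∀ {u v w} → R u v → Walk R v w → Walk R u w

HasCycle : {A : Set} → (A → A → Set) → Set
HasCycle {A} R = Σ A λ v → Σ (List A) λ vs →
  (2 ≤ length vs) × Unique (v ∷ vs) × Linked R ((v ∷ vs) ++ [ v ])

Acyclic : {A : Set} → (A → A → Set) → Set
Acyclic R = ¬ HasCycle R

IsVertexCover : ∀ {n} → Graph n → Subset n → Set
IsVertexCover G S = ∀ u v → Edge G u v → (u ∈ S) ⊎ (v ∈ S)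

InVk : ℕ → ∀ {n} → Graph n → Set
InVk k {n} G = ∃[ S ] (IsVertexCover G S × ∣ S ∣ ≤ k)

-- A partition 𝒳 = {X_1,…,X_p} of a subset of V(G) into non-empty parts is
-- encoded by  part : Fin n → Maybe (Fin p)  (part v = just i iff v ∈ X_i),
-- with every part non-empty.

NonEmptyParts : ∀ {n p} → (Fin n → Maybe (Fin p)) → Set
NonEmptyParts {n} {p} part = ∀ (i : Fin p) → ∃[ v ] (part v ≡ just i)

order : ∀ {n p} → (Fin n → Maybe (Fin p)) → ℕ
order part = ∣ tabulate (λ v → is-just (part v)) ∣

qmap : ∀ {n p} → (Fin n → Maybe (Fin p)) → Fin n → Fin p ⊎ Fin n
qmap part v with part v
... | just i  = inj₁ i
... | nothing = inj₂ v

-- Adjacency of G//𝒳 (vertex set = image of qmap): two distinct vertices are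
-- adjacent iff some edge of G joins their preimages.
QAdj : ∀ {n p} → Graph n → (Fin n → Maybe (Fin p)) →
       Fin p ⊎ Fin n → Fin p ⊎ Fin n → Set
QAdj G part a b =
  (a ≢ b) × ∃[ u ] ∃[ v ] (Edge G u v × qmap part u ≡ a × qmap part v ≡ b)

InFk : ℕ → ∀ {n} → Graph n → Set
InFk k {n} G = ∃[ p ] Σ (Fin n → Maybe (Fin p)) λ part →
  NonEmptyParts part × order part ≤ k × Acyclic (QAdj G part)

record Minor {m n} (H : Graph m) (G : Graph n) : Set where
  field
    β         : Fin n → Maybe (Fin m)
    nonempty  : ∀ i → ∃[ u ] (β u ≡ just i)
    connected : ∀ i u v → β u ≡ just i → β v ≡ just i →
                Walk (λ x y → Edge G x y × β x ≡ just i × β y ≡ just i) u v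
    edges     : ∀ i j → Edge H i j →
                ∃[ u ] ∃[ v ] (β u ≡ just i × β v ≡ just j × Edge G u v)

record Iso {m n} (H : Graph m) (G : Graph n) : Set where
  field
    σ        : Fin m ↔ Fin n
    preserve : ∀ u v → adj G (Inverse.to σ u) (Inverse.to σ v) ≡ adj H u v

ProperMinor : ∀ {m n} → Graph m → Graph n → Set
ProperMinor H G = Minor H G × ¬ Iso H G

GraphClass : Set₁
GraphClass = ∀ {n} → Graph n → Set

IsMinorObstruction : GraphClass → ∀ {n} → Graph n → Set
IsMinorObstruction C G =
  ¬ C G × (∀ {m} (H : Graph m) → ProperMinor H G → C H)

DeleteEdge : ∀ {n} → Graph n → Fin n → Fin n → Fin n → Fin n → Set
DeleteEdge G u v x y = Edge G x y × ¬ ((x ≡ u × y ≡ v) ⊎ (x ≡ v × y ≡ u))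

Bridgeless : ∀ {n} → Graph n → Set
Bridgeless G = ∀ u v → Edge G u v → Walk (DeleteEdge G u v) u v

{-# OPTIONS --safe #-}
module Submission where

-- If G//𝒳 is acyclic and G is bridgeless, the vertices identified by 𝒳 cover
-- every edge: an edge uv with both ends untouched survives in G//𝒳, and a u–v
-- walk in G − uv, which exists by bridgelessness, maps to a u–v walk in G//𝒳
-- that avoids uv and so closes a cycle with it. Hence F^(k) ⊆ V_k on bridgeless
-- graphs. Conversely, identifying a vertex cover to a single vertex leaves a
-- star, so V_k ⊆ F^(k): the proper minors of G stay in F^(k), while G itself,
-- being bridgeless, stays outside.

open import Defs
open import Data.Nat using (ℕ; _≤_; s≤s; z≤n)
open import Data.Fin as Fin using (Fin; zero)
open import Data.Fin.Subset using (Subset; _∈_)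
open import Data.Fin.Subset.Properties using (nonempty?; Empty-unique)
open import Data.Bool using (true; false)
open import Data.Maybe using (Maybe; just; nothing; is-just; when)
open import Data.Sum as Sum using (_⊎_; inj₁; inj₂)
open import Data.Sum.Properties using (≡-dec; inj₂-injective)
open import Data.Product as Product using (Σ; ∃-syntax; _×_; _,_; proj₁)
open import Data.List using (List; []; _∷_; _++_; [_]; length)
open import Data.List.Relation.Unary.All using (All; []; _∷_)
open import Data.List.Relation.Unary.All.Properties using (¬Any⇒All¬)
open import Data.List.Relation.Unary.AllPairs using ([]; _∷_)
open import Data.List.Relation.Unary.Any using (here; there)
open import Data.List.Relation.Unary.Linked using (Linked; [-]; _∷_)
open import Data.List.Relation.Unary.Unique.Propositional using (Unique)
import Data.List.Membership.Propositional as List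
import Data.List.Membership.DecPropositional as DecMembership
open import Data.Vec using (tabulate; lookup)
open import Data.Vec.Properties
  using (lookup∘tabulate; tabulate∘lookup; tabulate-cong; lookup⇒[]=; []=⇒lookup; lookup-replicate)
open import Data.Empty using (⊥-elim)
open import Function using (_∘_)
open import Relation.Nullary using (¬_; yes; no; Irrelevant)
open import Relation.Binary.Definitions using (DecidableEquality; Symmetric)
open import Relation.Binary.PropositionalEquality as ≡ using (_≡_; _≢_; refl; trans; cong; subst; subst₂)

vertices : ∀ {A} {R : A → A → Set} {u v} → Walk R u v → List A
vertices {u = u} here       = u ∷ []
vertices {u = u} (step _ w) = u ∷ vertices w

vertices-nonempty : ∀ {A} {R : A → A → Set} {u v} (w : Walk R u v) → 1 ≤ length (vertices w)
vertices-nonempty here       = s≤s z≤n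
vertices-nonempty (step _ _) = s≤s z≤n

Path : ∀ {A} → (A → A → Set) → A → A → Set
Path R u v = Σ (Walk R u v) λ w → Unique (vertices w)

Avoid : ∀ {A} → (A → A → Set) → A → A → A → A → Set
Avoid R a b x y = R x y × ¬ ((x ≡ a × y ≡ b) ⊎ (x ≡ b × y ≡ a))

Walk-collapse : ∀ {A B} {R : A → A → Set} {S : B → B → Set} (f : A → B) →
                (∀ {x y} → R x y → f x ≡ f y ⊎ S (f x) (f y)) →
                ∀ {x y} → Walk R x y → Walk S (f x) (f y)
Walk-collapse f image here = here
Walk-collapse {S = S} f image {y = y} (step r w) with image r
... | inj₁ same = subst (λ z → Walk S z (f y)) (≡.sym same) (Walk-collapse f image w)
... | inj₂ s    = step s (Walk-collapse f image w)

linked-closing : ∀ {A} {R R′ : A → A → Set} → (∀ {x y} → R′ x y → R x y) →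
                 ∀ {u v w} (p : Walk R′ u v) → R v w → Linked R (vertices p ++ [ w ])
linked-closing f here                   r = r ∷ [-]
linked-closing f (step r′ here)         r = f r′ ∷ r ∷ [-]
linked-closing f (step r′ p@(step _ _)) r = f r′ ∷ linked-closing f p r

module LoopErasure {A : Set} (_≟_ : DecidableEquality A) where
  open DecMembership _≟_ using (_∈?_)

  path-from : ∀ {R : A → A → Set} {x u v} (p : Walk R u v) → Unique (vertices p) →
              x List.∈ vertices p → Path R x v
  path-from here       !p       (here refl) = here , !p
  path-from (step r p) !p       (here refl) = step r p , !p
  path-from (step _ p) (_ ∷ !p) (there x∈p) = path-from p !p x∈p

  loop-erase : ∀ {R : A → A → Set} {u v} → Walk R u v → Path R u v
  loop-erase here = here , [] ∷ []
  loop-erase {u = u} (step r w) with loop-erase w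
  ... | p , !p with u ∈? vertices p
  ...   | yes u∈p = path-from p !p u∈p
  ...   | no  u∉p = step r p , ¬Any⇒All¬ (vertices p) u∉p ∷ !p

  cycle-from-detour : (R : A → A → Set) → Symmetric R → ∀ {a b} → R a b → a ≢ b →
                      Walk (Avoid R a b) a b → HasCycle R
  cycle-from-detour R R-sym {a} ab a≢b detour with loop-erase detour
  ... | here , _                      = ⊥-elim (a≢b refl)
  ... | step (_ , not-ab) here , _    = ⊥-elim (not-ab (inj₁ (refl , refl)))
  ... | step r p@(step _ q) , !path =
    a , vertices p , s≤s (vertices-nonempty q) , !path , linked-closing proj₁ (step r p) (R-sym ab)

acyclic-if-edges-meet-subsingleton :
  ∀ {A} {R : A → A → Set} (P : A → Set) → (∀ {x y} → P x → P y → x ≡ y) →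
  (∀ {x y} → R x y → P x ⊎ P y) → Acyclic R
acyclic-if-edges-meet-subsingleton P unique meets (_ , []        , ()      , _)
acyclic-if-edges-meet-subsingleton P unique meets (_ , _ ∷ []    , s≤s () , _)
acyclic-if-edges-meet-subsingleton {R = R} P unique meets
  (v , a ∷ b ∷ rest , _ , (v≢a ∷ v≢b ∷ _) ∷ (a≢b ∷ a≢rest) ∷ _ , va ∷ ab ∷ b-next) =
  a≢b (unique (middle va ab v≢b) (P-b rest a≢rest b-next))
  where
  middle : ∀ {x y z} → R x y → R y z → x ≢ z → P y
  middle xy yz x≢z with meets xy | meets yz
  ... | inj₂ Py | _       = Py
  ... | _       | inj₁ Py = Py
  ... | inj₁ Px | inj₂ Pz = ⊥-elim (x≢z (unique Px Pz))

  P-b : ∀ rest → All (a ≢_) rest → Linked R (b ∷ rest ++ [ v ]) → P b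
  P-b []      _         (bv ∷ _) = middle ab bv (v≢a ∘ ≡.sym)
  P-b (_ ∷ _) (a≢d ∷ _) (bd ∷ _) = middle ab bd a≢d

Edge-irrefl : ∀ {n} (G : Graph n) {u v} → Edge G u v → u ≢ v
Edge-irrefl G {u} uv refl with trans (≡.sym uv) (irrefl G u)
... | ()

-- X₁ ∪ ⋯ ∪ X_p, so that order part = ∣ identified part ∣ definitionally.
identified : ∀ {n p} → (Fin n → Maybe (Fin p)) → Subset n
identified part = tabulate (λ v → is-just (part v))

module Quotient {n p} (part : Fin n → Maybe (Fin p)) where

  identified-or-untouched : ∀ u → u ∈ identified part ⊎ part u ≡ nothing
  identified-or-untouched u with part u in eq
  ... | just _  = inj₁ (lookup⇒[]= u _ (trans (lookup∘tabulate _ u) (cong is-just eq)))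
  ... | nothing = inj₂ refl

  qmap-identified : ∀ {u} → u ∈ identified part → ∃[ i ] qmap part u ≡ inj₁ i
  qmap-identified {u} u∈
    with part u | trans (≡.sym (lookup∘tabulate (λ v → is-just (part v)) u)) ([]=⇒lookup u∈)
  ... | just i  | _ = i , refl
  ... | nothing | ()

  qmap-untouched : ∀ {u} → part u ≡ nothing → qmap part u ≡ inj₂ u
  qmap-untouched {u} eq with part u
  ... | nothing = refl

  qmap≡inj₂⇒≡ : ∀ {u w} → qmap part u ≡ inj₂ w → u ≡ w
  qmap≡inj₂⇒≡ {u} eq with part u
  ... | nothing = inj₂-injective eq

module _ {n p} (G : Graph n) (part : Fin n → Maybe (Fin p)) where
  open Quotient part

  _≟_ : DecidableEquality (Fin p ⊎ Fin n)
  _≟_ = ≡-dec Fin._≟_ Fin._≟_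

  QAdj-sym : Symmetric (QAdj G part)
  QAdj-sym (a≢b , u , v , uv , refl , refl) =
    a≢b ∘ ≡.sym , v , u , trans (Graph.sym G v u) uv , refl , refl

  detour-in-quotient : ∀ {u v} → part u ≡ nothing → part v ≡ nothing →
                       Walk (DeleteEdge G u v) u v →
                       Walk (Avoid (QAdj G part) (inj₂ u) (inj₂ v)) (inj₂ u) (inj₂ v)
  detour-in-quotient {u} {v} pu pv w =
    subst₂ (Walk _) (qmap-untouched pu) (qmap-untouched pv) (Walk-collapse (qmap part) image w)
    where
    image : ∀ {x y} → DeleteEdge G u v x y →
            qmap part x ≡ qmap part y ⊎
            Avoid (QAdj G part) (inj₂ u) (inj₂ v) (qmap part x) (qmap part y)
    image {x} {y} (xy , not-uv) with qmap part x ≟ qmap part y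
    ... | yes same   = inj₁ same
    ... | no  differ = inj₂ ((differ , x , y , xy , refl , refl) , not-uv ∘ Sum.map untouched untouched)
      where
      untouched : ∀ {a b} → qmap part x ≡ inj₂ a × qmap part y ≡ inj₂ b → x ≡ a × y ≡ b
      untouched = Product.map qmap≡inj₂⇒≡ qmap≡inj₂⇒≡

  identified-cover : Bridgeless G → Acyclic (QAdj G part) → IsVertexCover G (identified part)
  identified-cover bridgeless acyclic u v uv
    with identified-or-untouched u | identified-or-untouched v
  ... | inj₁ u∈ | _       = inj₁ u∈
  ... | _       | inj₁ v∈ = inj₂ v∈
  ... | inj₂ pu | inj₂ pv = ⊥-elim (acyclic (cycle-from-detour (QAdj G part) QAdj-sym
          (differ , u , v , uv , qmap-untouched pu , qmap-untouched pv) differ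
          (detour-in-quotient pu pv (bridgeless u v uv))))
    where
    open LoopErasure _≟_
    differ : inj₂ u ≢ inj₂ v
    differ = Edge-irrefl G uv ∘ inj₂-injective

  quotient-acyclic-if-identified-cover : Irrelevant (Fin p) → IsVertexCover G (identified part) →
                                         Acyclic (QAdj G part)
  quotient-acyclic-if-identified-cover one-part cover =
    acyclic-if-edges-meet-subsingleton IsNew unique meets
    where
    IsNew : Fin p ⊎ Fin n → Set
    IsNew x = ∃[ i ] x ≡ inj₁ i
    unique : ∀ {x y} → IsNew x → IsNew y → x ≡ y
    unique (i , refl) (j , refl) = cong inj₁ (one-part i j)
    meets : ∀ {x y} → QAdj G part x y → IsNew x ⊎ IsNew y
    meets (_ , u , v , uv , refl , refl) = Sum.map qmap-identified qmap-identified (cover u v uv)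

identified-≡ : ∀ {n p} {part : Fin n → Maybe (Fin p)} {S : Subset n} →
               (∀ v → is-just (part v) ≡ lookup S v) → identified part ≡ S
identified-≡ {S = S} agree = trans (tabulate-cong agree) (tabulate∘lookup S)

single-part-partition : ∀ {n} (S : Subset n) →
  ∃[ p ] (Irrelevant (Fin p) × Σ (Fin n → Maybe (Fin p)) λ part →
          NonEmptyParts part × identified part ≡ S)
single-part-partition S with nonempty? S
... | yes (w , w∈S) =
  1 , (λ { zero zero → refl }) , (λ v → when (lookup S v) zero) ,
  (λ { zero → w , cong (λ b → when b zero) ([]=⇒lookup w∈S) }) ,
  identified-≡ (is-just-when ∘ lookup S)
  where
  is-just-when : ∀ b → is-just (when b zero) ≡ b
  is-just-when true  = refl
  is-just-when false = refl
... | no empty =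
  0 , (λ ()) , (λ _ → nothing) , (λ ()) ,
  identified-≡ {p = 0} λ v →
    trans (≡.sym (lookup-replicate v false)) (cong (λ T → lookup T v) (≡.sym (Empty-unique empty)))

bridgeless-Fk⇒Vk : ∀ k {n} (G : Graph n) → Bridgeless G → InFk k G → InVk k G
bridgeless-Fk⇒Vk k G bridgeless (_ , part , _ , order≤k , acyclic) =
  identified part , identified-cover G part bridgeless acyclic , order≤k

Vk⇒Fk : ∀ k {n} (G : Graph n) → InVk k G → InFk k G
Vk⇒Fk k G (S , cover , ∣S∣≤k) with single-part-partition S
... | p , one-part , part , nonempty , refl =
  p , part , nonempty , ∣S∣≤k , quotient-acyclic-if-identified-cover G part one-part cover

obstruction-transfer : {C D : GraphClass} → (∀ {m} (H : Graph m) → C H → D H) →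
                       ∀ {n} (G : Graph n) → (D G → C G) →
                       IsMinorObstruction C G → IsMinorObstruction D G
obstruction-transfer C⊆D G D⇒C (G∉C , minors∈C) =
  G∉C ∘ D⇒C , λ H H<G → C⊆D H (minors∈C H H<G)

lemma4p2 : (k : ℕ) → ∀ {n} (G : Graph n) → Bridgeless G →
    IsMinorObstruction (InVk k) G → IsMinorObstruction (InFk k) G
lemma4p2 k G bridgeless = obstruction-transfer (Vk⇒Fk k) G (bridgeless-Fk⇒Vk k G bridgeless)
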